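{- The cut rule is admissible in $\mathsf{GWFI}$: for all finite multisets $\Gamma,\Gamma'$ of formulas and all formulas $D,E$, if $\Gamma\Rightarrow D$ and $D,\Gamma'\Rightarrow E$ are derivable in $\mathsf{GWFI}$, then $\Gamma,\Gamma'\Rightarrow E$ is derivable in $\mathsf{GWFI}$.
   Context: Formulas are built from a countable set of propositional atoms and $\bot$ using $\wedge,\vee,\rightarrow$. Sequents of $\mathsf{GWFI}$ have the form $\Gamma\Rightarrow C$ with $\Gamma$ a finite multiset of formulas and $C$ a single formula. Rules ($p$ atomic, $\Gamma$ arbitrary): (Ax) $p,\Gamma\Rightarrow p$; ($\bot_L$) $\bot,\Gamma\Rightarrow C$; ($\wedge_L$) from $A,B,\Gamma\Rightarrow C$ infer $A\wedge B,\Gamma\Rightarrow C$; ($\wedge_R$) from $\Gamma\Rightarrow A$ and $\Gamma\Rightarrow B$ infer $\Gamma\Rightarrow A\wedge B$; ($\vee_L$) from $A,\Gamma\Rightarrow C$ and $B,\Gamma\Rightarrow C$ infer $A\vee B,\Gamma\Rightarrow C$; ($\vee_R^1$) from $\Gamma\Rightarrow A$ infer $\Gamma\Rightarrow A\vee B$; ($\vee_R^2$) from $\Gamma\Rightarrow B$ infer $\Gamma\Rightarrow A\vee B$; ($\rightarrow_R$) from $A\Rightarrow B$ infer $\Gamma\Rightarrow A\rightarrow B$; ($\rightarrow_{LR}$) from $A\Rightarrow B$, $B\Rightarrow A$, $C\Rightarrow D$, $D\Rightarrow C$ infer $\Gamma,A\rightarrow C\Rightarrow B\rightarrow D$; ($\rightarrow_I$)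 from $\Gamma\Rightarrow B\rightarrow C$ and $\Gamma\Rightarrow C\rightarrow D$ infer $\Gamma\Rightarrow B\rightarrow D$. Derivability uses only these rules, without cut. -}

module Defs where

open import Data.Nat using (ℕ)
open import Data.List using (List; []; _∷_; [_]; _++_)
open import Data.List.Relation.Binary.Permutation.Propositional using (_↭_)

data Fm : Set where
  atom : ℕ → Fm
  ⊥'   : Fm
  _∧'_ : Fm → Fm → Fm
  _∨'_ : Fm → Fm → Fm
  _⇒'_ : Fm → Fm → Fm

infixr 6 _∧'_
infixr 5 _∨'_
infixr 4 _⇒'_

-- Antecedents are finite multisets, represented as lists taken up to
-- permutation: every rule whose conclusion has a designated antecedent
-- formula / context concludes any list Δ that is a permutation of it.
Ctx : Set
Ctx = List Fm

infix 2 _⊢_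

data _⊢_ : Ctx → Fm → Set where
  ax   : ∀ {Δ Γ} p → Δ ↭ (atom p ∷ Γ) → Δ ⊢ atom p
  ⊥L   : ∀ {Δ Γ C} → Δ ↭ (⊥' ∷ Γ) → Δ ⊢ C
  ∧L   : ∀ {Δ Γ A B C} → Δ ↭ ((A ∧' B) ∷ Γ) → (A ∷ B ∷ Γ) ⊢ C → Δ ⊢ C
  ∧R   : ∀ {Γ A B} → Γ ⊢ A → Γ ⊢ B → Γ ⊢ A ∧' B
  ∨L   : ∀ {Δ Γ A B C} → Δ ↭ ((A ∨' B) ∷ Γ) →
         (A ∷ Γ) ⊢ C → (B ∷ Γ) ⊢ C → Δ ⊢ C
  ∨R₁  : ∀ {Γ A B} → Γ ⊢ A → Γ ⊢ A ∨' B
  ∨R₂  : ∀ {Γ A B} → Γ ⊢ B → Γ ⊢ A ∨' B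
  ⇒R   : ∀ {Γ A B} → [ A ] ⊢ B → Γ ⊢ A ⇒' B
  ⇒LR  : ∀ {Δ Γ A B C D} → Δ ↭ ((A ⇒' C) ∷ Γ) →
         [ A ] ⊢ B → [ B ] ⊢ A → [ C ] ⊢ D → [ D ] ⊢ C →
         Δ ⊢ B ⇒' D
  ⇒I   : ∀ {Γ B C D} → Γ ⊢ B ⇒' C → Γ ⊢ C ⇒' D → Γ ⊢ B ⇒' D

{-# OPTIONS --safe #-}
-- Cut is eliminated in its context-sharing form Θ ⊢ D → D ∷ Θ ⊢ E → Θ ⊢ E (the
-- theorem follows by weakening), by induction on D and then on the derivation
-- of Θ ⊢ D.  Left rules there commute with the cut because ∧L and ∨L are
-- invertible; ∧R and ∨R reduce it to cuts on subformulas, again by inversion;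
-- an axiom reduces it to contraction of an atom.  For D = B ⇒ D′ the derivation
-- of D ∷ Θ ⊢ E is analysed instead: D can only be principal in ⇒LR, whose
-- conclusion B″ ⇒ D″ then follows by ⇒I from B″ ⇒ B, B ⇒ D′ and D′ ⇒ D″, while
-- ⇒R discards the antecedent and every other rule commutes with the cut.
module Submission where

open import Defs
open import Data.List using (List; []; _∷_; [_]; _++_)
open import Data.List.Relation.Binary.Permutation.Propositional
open import Data.List.Relation.Binary.Permutation.Propositional.Properties
  using (∈-resp-↭; shift; shifts; drop-∷; ++⁺ˡ; ++-comm)
open import Data.List.Membership.Propositional using (_∈_)
open import Data.List.Membership.Propositional.Properties using (∈-∃++)
open import Data.List.Relation.Unary.Any using (here; there)
open import Data.Product using (∃; _×_; _,_; proj₂)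
open import Data.Sum using (_⊎_; inj₁; inj₂)
open import Data.Empty using (⊥-elim)
open import Relation.Binary.PropositionalEquality using (_≡_; _≢_; refl)
open import Relation.Nullary using (¬_)

module _ {a} {A : Set a} where

  ∈⇒↭∷ : ∀ {x : A} {xs} → x ∈ xs → ∃ λ ys → xs ↭ x ∷ ys
  ∈⇒↭∷ x∈xs with ys , zs , refl ← ∈-∃++ x∈xs = ys ++ zs , shift _ ys zs

  ++-↭-∷ : ∀ zs {xs : List A} {x ys} → xs ↭ x ∷ ys → zs ++ xs ↭ x ∷ zs ++ ys
  ++-↭-∷ zs {x = x} {ys} xs↭ = ↭-trans (++⁺ˡ zs xs↭) (shift x zs ys)

  two-heads : ∀ {zs : List A} {x xs y ys} → zs ↭ x ∷ xs → zs ↭ y ∷ ys →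
              (x ≡ y × xs ↭ ys) ⊎ (∃ λ ws → ys ↭ x ∷ ws × xs ↭ y ∷ ws)
  two-heads p q = ∷↭∷-cases (↭-trans (↭-sym p) q)
    where
    ∷↭∷-cases : ∀ {x xs y ys} → x ∷ xs ↭ y ∷ ys →
                (x ≡ y × xs ↭ ys) ⊎ (∃ λ ws → ys ↭ x ∷ ws × xs ↭ y ∷ ws)
    ∷↭∷-cases {x} {y = y} σ with ∈-resp-↭ σ (here refl)
    ... | here refl  = inj₁ (refl , drop-∷ σ)
    ... | there x∈ys with ws , ys↭ ← ∈⇒↭∷ x∈ys =
      inj₂ (ws , ys↭ , drop-∷ (↭-trans σ (↭-trans (prep y ys↭) (swap y x ↭-refl))))

  distinct-heads : ∀ {zs : List A} {x xs y ys} → zs ↭ x ∷ xs → zs ↭ y ∷ ys → x ≢ y →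
                   ∃ λ ws → ys ↭ x ∷ ws × xs ↭ y ∷ ws
  distinct-heads p q x≢y with two-heads p q
  ... | inj₁ (x≡y , _) = ⊥-elim (x≢y x≡y)
  ... | inj₂ r         = r

  ∈-↭∷-≢ : ∀ {y x : A} {zs xs} → y ∈ zs → zs ↭ x ∷ xs → y ≢ x → y ∈ xs
  ∈-↭∷-≢ y∈zs p y≢x with ∈-resp-↭ p y∈zs
  ... | here y≡x = ⊥-elim (y≢x y≡x)
  ... | there y∈xs = y∈xs

exchange : ∀ {Δ Δ′ C} → Δ ↭ Δ′ → Δ ⊢ C → Δ′ ⊢ C
exchange σ (ax p q) = ax p (↭-trans (↭-sym σ) q)
exchange σ (⊥L q) = ⊥L (↭-trans (↭-sym σ) q)
exchange σ (∧L q d) = ∧L (↭-trans (↭-sym σ) q) d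
exchange σ (∧R d e) = ∧R (exchange σ d) (exchange σ e)
exchange σ (∨L q d e) = ∨L (↭-trans (↭-sym σ) q) d e
exchange σ (∨R₁ d) = ∨R₁ (exchange σ d)
exchange σ (∨R₂ d) = ∨R₂ (exchange σ d)
exchange σ (⇒R d) = ⇒R d
exchange σ (⇒LR q a b c d) = ⇒LR (↭-trans (↭-sym σ) q) a b c d
exchange σ (⇒I d e) = ⇒I (exchange σ d) (exchange σ e)

weakenˡ : ∀ {Δ C} Σ → Δ ⊢ C → Σ ++ Δ ⊢ C
weakenˡ Σ (ax p q) = ax p (++-↭-∷ Σ q)
weakenˡ Σ (⊥L q) = ⊥L (++-↭-∷ Σ q)
weakenˡ Σ (∧L {A = A} {B} q d) =
  ∧L (++-↭-∷ Σ q) (exchange (shifts Σ (A ∷ B ∷ [])) (weakenˡ Σ d))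
weakenˡ Σ (∧R d e) = ∧R (weakenˡ Σ d) (weakenˡ Σ e)
weakenˡ Σ (∨L {A = A} {B} q d e) =
  ∨L (++-↭-∷ Σ q) (exchange (shifts Σ [ A ]) (weakenˡ Σ d))
                  (exchange (shifts Σ [ B ]) (weakenˡ Σ e))
weakenˡ Σ (∨R₁ d) = ∨R₁ (weakenˡ Σ d)
weakenˡ Σ (∨R₂ d) = ∨R₂ (weakenˡ Σ d)
weakenˡ Σ (⇒R d) = ⇒R d
weakenˡ Σ (⇒LR q a b c d) = ⇒LR (++-↭-∷ Σ q) a b c d
weakenˡ Σ (⇒I d e) = ⇒I (weakenˡ Σ d) (weakenˡ Σ e)

weakenʳ : ∀ {Δ C} Σ → Δ ⊢ C → Δ ++ Σ ⊢ C
weakenʳ {Δ} Σ d = exchange (++-comm Σ Δ) (weakenˡ Σ d)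

-- X ⇝ Ys: some premise of the left rule for X has X replaced by Ys.
infix 3 _⇝_

data _⇝_ : Fm → List Fm → Set where
  ∧⇝  : ∀ {A B} → A ∧' B ⇝ A ∷ B ∷ []
  ∨⇝₁ : ∀ {A B} → A ∨' B ⇝ [ A ]
  ∨⇝₂ : ∀ {A B} → A ∨' B ⇝ [ B ]

⇝-≢ : ∀ {X Ys Y} → X ⇝ Ys → (∀ {Zs} → ¬ (Y ⇝ Zs)) → Y ≢ X
⇝-≢ X⇝ ¬Y⇝ refl = ¬Y⇝ X⇝

invert : ∀ {X Ys Δ Γ C} → X ⇝ Ys → Δ ⊢ C → Δ ↭ X ∷ Γ → Ys ++ Γ ⊢ C
invert {Ys = Ys} X⇝ (ax p q) r with _ , s , _ ← distinct-heads q r (⇝-≢ X⇝ λ ()) =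
  ax p (++-↭-∷ Ys s)
invert {Ys = Ys} X⇝ (⊥L q) r with _ , s , _ ← distinct-heads q r (⇝-≢ X⇝ λ ()) =
  ⊥L (++-↭-∷ Ys s)
invert {Ys = Ys} X⇝ (⇒LR q a b c d) r with _ , s , _ ← distinct-heads q r (⇝-≢ X⇝ λ ()) =
  ⇒LR (++-↭-∷ Ys s) a b c d
invert X⇝ (∧L q d) r with two-heads q r
invert ∧⇝ (∧L q d) r | inj₁ (refl , t) = exchange (prep _ (prep _ t)) d
invert {Ys = Ys} X⇝ (∧L {A = A} {B} q d) r | inj₂ (_ , s , t) =
  ∧L (++-↭-∷ Ys s)
     (exchange (shifts Ys (A ∷ B ∷ [])) (invert X⇝ d (++-↭-∷ (A ∷ B ∷ []) t)))
invert X⇝ (∨L q d e) r with two-heads q r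
invert ∨⇝₁ (∨L q d e) r | inj₁ (refl , t) = exchange (prep _ t) d
invert ∨⇝₂ (∨L q d e) r | inj₁ (refl , t) = exchange (prep _ t) e
invert {Ys = Ys} X⇝ (∨L {A = A} {B} q d e) r | inj₂ (_ , s , t) =
  ∨L (++-↭-∷ Ys s)
     (exchange (shifts Ys [ A ]) (invert X⇝ d (++-↭-∷ [ A ] t)))
     (exchange (shifts Ys [ B ]) (invert X⇝ e (++-↭-∷ [ B ] t)))
invert X⇝ (∧R d e) r = ∧R (invert X⇝ d r) (invert X⇝ e r)
invert X⇝ (∨R₁ d)  r = ∨R₁ (invert X⇝ d r)
invert X⇝ (∨R₂ d)  r = ∨R₂ (invert X⇝ d r)
invert X⇝ (⇒R d)   r = ⇒R d
invert X⇝ (⇒I d e) r = ⇒I (invert X⇝ d r) (invert X⇝ e r)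

contract-atom : ∀ {p Δ Γ C} → Δ ⊢ C → Δ ↭ atom p ∷ Γ → atom p ∈ Γ → Γ ⊢ C
contract-atom (ax q r) s p∈Γ with two-heads r s
... | inj₁ (refl , _)  = ax q (proj₂ (∈⇒↭∷ p∈Γ))
... | inj₂ (_ , t , _) = ax q t
contract-atom (⊥L q) s _ with _ , t , _ ← distinct-heads q s (λ ()) = ⊥L t
contract-atom (⇒LR q a b c d) s _ with _ , t , _ ← distinct-heads q s (λ ()) = ⇒LR t a b c d
contract-atom (∧L {A = A} {B} q d) s p∈Γ with _ , t , u ← distinct-heads q s (λ ()) =
  ∧L t (contract-atom d (++-↭-∷ (A ∷ B ∷ []) u) (there (there (∈-↭∷-≢ p∈Γ t λ ()))))
contract-atom (∨L {A = A} {B} q d e) s p∈Γ with _ , t , u ← distinct-heads q s (λ ()) =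
  ∨L t (contract-atom d (++-↭-∷ [ A ] u) (there (∈-↭∷-≢ p∈Γ t λ ())))
       (contract-atom e (++-↭-∷ [ B ] u) (there (∈-↭∷-≢ p∈Γ t λ ())))
contract-atom (∧R d e) s p∈Γ = ∧R (contract-atom d s p∈Γ) (contract-atom e s p∈Γ)
contract-atom (∨R₁ d)  s p∈Γ = ∨R₁ (contract-atom d s p∈Γ)
contract-atom (∨R₂ d)  s p∈Γ = ∨R₂ (contract-atom d s p∈Γ)
contract-atom (⇒R d)   _ _   = ⇒R d
contract-atom (⇒I d e) s p∈Γ = ⇒I (contract-atom d s p∈Γ) (contract-atom e s p∈Γ)

cut-⇒ : ∀ {Θ Δ B D E} → Θ ⊢ B ⇒' D → Δ ⊢ E → Δ ↭ (B ⇒' D) ∷ Θ → Θ ⊢ E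
cut-⇒ _ (ax p q) r with _ , s , _ ← distinct-heads q r (λ ()) = ax p s
cut-⇒ _ (⊥L q)   r with _ , s , _ ← distinct-heads q r (λ ()) = ⊥L s
cut-⇒ ⊢B⇒D (∧L {A = A} {B} q d) r with _ , s , t ← distinct-heads q r (λ ()) =
  ∧L s (cut-⇒ (invert ∧⇝ ⊢B⇒D s) d (++-↭-∷ (A ∷ B ∷ []) t))
cut-⇒ ⊢B⇒D (∨L {A = A} {B} q d e) r with _ , s , t ← distinct-heads q r (λ ()) =
  ∨L s (cut-⇒ (invert ∨⇝₁ ⊢B⇒D s) d (++-↭-∷ [ A ] t))
       (cut-⇒ (invert ∨⇝₂ ⊢B⇒D s) e (++-↭-∷ [ B ] t))
cut-⇒ ⊢B⇒D (⇒LR q a b c d) r with two-heads q r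
... | inj₁ (refl , _)  = ⇒I (⇒I (⇒R b) ⊢B⇒D) (⇒R c)
... | inj₂ (_ , s , _) = ⇒LR s a b c d
cut-⇒ ⊢B⇒D (∧R d e) r = ∧R (cut-⇒ ⊢B⇒D d r) (cut-⇒ ⊢B⇒D e r)
cut-⇒ ⊢B⇒D (∨R₁ d)  r = ∨R₁ (cut-⇒ ⊢B⇒D d r)
cut-⇒ ⊢B⇒D (∨R₂ d)  r = ∨R₂ (cut-⇒ ⊢B⇒D d r)
cut-⇒ _    (⇒R d)   _ = ⇒R d
cut-⇒ ⊢B⇒D (⇒I d e) r = ⇒I (cut-⇒ ⊢B⇒D d r) (cut-⇒ ⊢B⇒D e r)

cut : ∀ {Θ E} D → Θ ⊢ D → D ∷ Θ ⊢ E → Θ ⊢ E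
cut _ (ax p q) e = contract-atom e ↭-refl (∈-resp-↭ (↭-sym q) (here refl))
cut _ (⊥L q)   _ = ⊥L q
cut D (∧L {A = A} {B} q d) e =
  ∧L q (cut D d (exchange (shifts (A ∷ B ∷ []) [ D ]) (invert ∧⇝ e (++-↭-∷ [ D ] q))))
cut D (∨L {A = A} {B} q d₁ d₂) e =
  ∨L q (cut D d₁ (exchange (shifts [ A ] [ D ]) (invert ∨⇝₁ e (++-↭-∷ [ D ] q))))
       (cut D d₂ (exchange (shifts [ B ] [ D ]) (invert ∨⇝₂ e (++-↭-∷ [ D ] q))))
cut (A ∧' B) (∧R a b) e =
  cut A a (cut B (weakenˡ [ A ] b) (exchange (swap A B ↭-refl) (invert ∧⇝ e ↭-refl)))
cut (A ∨' B) (∨R₁ a)  e = cut A a (invert ∨⇝₁ e ↭-refl)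
cut (A ∨' B) (∨R₂ b)  e = cut B b (invert ∨⇝₂ e ↭-refl)
cut (A ⇒' B) d        e = cut-⇒ d e ↭-refl

mainTheorem11 : (Γ Γ′ : List Fm) (D E : Fm) →
    Γ ⊢ D → (D ∷ Γ′) ⊢ E → (Γ ++ Γ′) ⊢ E
mainTheorem11 Γ Γ′ D E ⊢D D⊢E =
  cut D (weakenʳ Γ′ ⊢D) (exchange (shift D Γ Γ′) (weakenˡ Γ D⊢E))
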